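{- For every $n\in\{0,1,2,\ldots\}$, \begin{align*} \sum_{j=0}^{n} \sum_{i=0}^j \frac{\binom{2n+2}{i}}{\binom{2n+1}{j}} & = (n+1) \sum_{k=0}^{n} \frac{1}{2k+1} = (n+1)\left( H_{2n+1}-\frac{H_{n}}{2} \right), \\ \sum_{j=0}^{n} \sum_{i=0}^j \frac{\binom{2n+3}{i}}{\binom{2n+1}{j}} & = (n+1) H_{n+1}, \\ \sum_{j=0}^{n} \sum_{i=0}^j \frac{\binom{2n+1}{i}}{\binom{2n}{j}} & = \frac{2^{2n-1}}{\binom{2n}{n}} + \left(n+\frac{1}{2}\right) \left( H_{2n+1}-\frac{H_{n}}{2} \right), \\ \sum_{j=0}^{n} \sum_{i=0}^j \frac{\binom{2n+2}{i}}{\binom{2n}{j}} & = \frac{2^{2n}}{\binom{2n}{n}} + \left(n+\frac{1}{2}\right)H_n. \end{align*}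
   Context: $H_m=\sum_{k=1}^m \frac1k$ denotes the $m$-th harmonic number ($H_0=0$). -}

module Defs where

open import Data.Nat using (ℕ; zero; suc)
import Data.Nat as ℕ
open import Data.Integer using (+_)
open import Data.Rational using (ℚ; 0ℚ; _+_; _/_)

-- a ÷ℕ b : the rational a / b for naturals a, b.
-- Convention a ÷ℕ 0 = 0 (never used in the theorem: all denominators are
-- binomial coefficients C(m, j) with j ≤ m, which are positive).
_÷ℕ_ : ℕ → ℕ → ℚ
a ÷ℕ zero  = 0ℚ
a ÷ℕ suc b = (+ a) / suc b

infixl 7 _÷ℕ_

Σ≤ : ℕ → (ℕ → ℚ) → ℚ
Σ≤ zero    f = f zero
Σ≤ (suc n) f = Σ≤ n f + f (suc n)

H : ℕ → ℚ
H zero    = 0ℚ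
H (suc m) = H m + (1 ÷ℕ suc m)

module Submission where

-- Write x_N(j) = (Σ_{i≤j} C(N+1,i)) / C(N,j) and P_N(k) = Σ_{j≤k} x_N(j), so that
-- the double sums of the theorem are P_{2n+1}(n), P_{2n}(n) and their analogues
-- with numerator row N+2.  The proof is elementary and follows three threads.
--  * Binomial facts in ℕ: absorption, (N+1-j)·C(N+1,j) = (N+1)·C(N,j), the
--    partial-row identity Σ_{i≤j} C(m+1,i) + C(m,j) = 2·Σ_{i≤j} C(m,i), and the
--    central values C(2n+2,n+1) = 2·C(2n+1,n), Σ_{i≤n} C(2n+1,i) = 4ⁿ.
--  * Two recurrences for x_N(j), one in j and one in N; summing them gives
--    (N+1)·P_{N+1}(k) + (k+1)·x_N(k) = (N+2)·P_N(k)   (`partial-raise`).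
--  * An induction on n using `partial-raise` at N = 2n and N = 2n+1 and the
--    central relation x_{2n+1}(n) + 1 = x_{2n+2}(n+1) proves
--    P_{2n}(n) = x_{2n}(n)/2 + (n+½)·O_n and P_{2n+1}(n) = (n+1)·O_n with
--    O_n = Σ_{k≤n} 1/(2k+1) = H_{2n+1} - H_n/2.  The row-(N+2) sums differ from
--    2·P_N(n) by (N+1)·(H_{N+1} - H_{N-n}), which gives the other two identities.

open import Defs
open import Data.Nat as ℕ using (ℕ; zero; suc; _≤_; z≤n; s≤s; _∸_)
import Data.Nat.Properties as ℕ
open import Data.Nat.Combinatorics using (_C_; nCk+nC[k+1]≡[n+1]C[k+1])
open import Data.Nat.Tactic.RingSolver using () renaming (ring to ℕ-ring)
open import Data.Integer.Tactic.RingSolver using () renaming (ring to ℤ-ring)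
open import Tactic.RingSolver using (solve; solve-∀)
open import Data.List using (_∷_; [])
open import Data.Product using (_×_; _,_)
open import Data.Empty using (⊥-elim)
open import Data.Sum using (inj₁; inj₂)
open import Relation.Nullary.Decidable using (dec⇒maybe)
open import Relation.Binary.PropositionalEquality
  using (_≡_; _≢_; refl; sym; trans; cong; cong₂; module ≡-Reasoning)

module Binomial where

  open import Data.Nat using (_+_; _*_; _^_)
  open import Data.Nat.Properties
    using (*-zeroʳ; *-distribˡ-+; *-distribʳ-+; +-cancelˡ-≡; +-cancelʳ-≡; *-cancelˡ-≡; *-suc;
           m+[n∸m]≡n; m≤n⇒m≤1+n; m+n≡0⇒m≡0)
  open ≡-Reasoning

  -- Pascal's triangle by its recursion; it agrees with the library's n C k
  -- (`C≡choose`) but, unlike it, unfolds definitionally.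
  choose : ℕ → ℕ → ℕ
  choose n       zero    = 1
  choose zero    (suc k) = 0
  choose (suc n) (suc k) = choose n k + choose n (suc k)

  C≡choose : ∀ n k → n C k ≡ choose n k
  C≡choose n       zero    = refl
  C≡choose zero    (suc k) = refl
  C≡choose (suc n) (suc k) =
    trans (sym (nCk+nC[k+1]≡[n+1]C[k+1] n k)) (cong₂ _+_ (C≡choose n k) (C≡choose n (suc k)))

  choose-nonzero : ∀ {n k} → k ≤ n → choose n k ≢ 0
  choose-nonzero {n}     {zero}  _         ()
  choose-nonzero {suc n} {suc k} (s≤s k≤n) h =
    choose-nonzero k≤n (m+n≡0⇒m≡0 (choose n k) h)

  absorption : ∀ N j → suc j * choose (suc N) (suc j) ≡ suc N * choose N j
  absorption zero    zero    = refl
  absorption zero    (suc j) = *-zeroʳ (suc (suc j))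
  absorption (suc N) zero    = cong (1 +_) (absorption N 0)
  absorption (suc N) (suc j) = begin
    suc (suc j) * (b + b′)               ≡⟨ split j b b′ ⟩
    b + (suc j * b + suc (suc j) * b′)   ≡⟨ cong₂ (λ u v → b + (u + v)) (absorption N j) (absorption N (suc j)) ⟩
    b + (suc N * choose N j + suc N * choose N (suc j))
      ≡⟨ merge N (choose N j) (choose N (suc j)) ⟩
    suc (suc N) * b                      ∎
    where
    b  = choose (suc N) (suc j)
    b′ = choose (suc N) (suc (suc j))
    split : ∀ j b b′ → suc (suc j) * (b + b′) ≡ b + (suc j * b + suc (suc j) * b′)
    split = solve-∀ ℕ-ring
    merge : ∀ N p q → (p + q) + (suc N * p + suc N * q) ≡ suc (suc N) * (p + q)
    merge = solve-∀ ℕ-ring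

  choose-shift : ∀ N j → suc N * choose (suc N) j ≡ j * choose (suc N) j + suc N * choose N j
  choose-shift N zero    = refl
  choose-shift N (suc j) = begin
    suc N * (choose N j + choose N (suc j))               ≡⟨ *-distribˡ-+ (suc N) (choose N j) _ ⟩
    suc N * choose N j + suc N * choose N (suc j)         ≡⟨ cong (_+ suc N * choose N (suc j)) (sym (absorption N j)) ⟩
    suc j * choose (suc N) (suc j) + suc N * choose N (suc j) ∎

  choose-complement : ∀ {N j} → j ≤ N → (suc N ∸ j) * choose (suc N) j ≡ suc N * choose N j
  choose-complement {N} {j} j≤N = +-cancelˡ-≡ (j * E) _ _ (begin
    j * E + (suc N ∸ j) * E   ≡⟨ sym (*-distribʳ-+ E j (suc N ∸ j)) ⟩
    (j + (suc N ∸ j)) * E     ≡⟨ cong (_* E) (m+[n∸m]≡n (m≤n⇒m≤1+n j≤N)) ⟩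
    suc N * E                 ≡⟨ choose-shift N j ⟩
    j * E + suc N * choose N j ∎)
    where E = choose (suc N) j

  rowSum : ℕ → ℕ → ℕ
  rowSum m zero    = 1
  rowSum m (suc j) = rowSum m j + choose m (suc j)

  -- Pascal's rule summed: the partial sums of row m+1 are almost twice those of row m.
  rowSum-double : ∀ m j → rowSum (suc m) j + choose m j ≡ 2 * rowSum m j
  rowSum-double m zero    = refl
  rowSum-double m (suc j) = begin
    rowSum (suc m) j + (choose m j + c) + c   ≡⟨ regroup (rowSum (suc m) j) (choose m j) c ⟩
    (rowSum (suc m) j + choose m j) + 2 * c   ≡⟨ cong (_+ 2 * c) (rowSum-double m j) ⟩
    2 * rowSum m j + 2 * c                    ≡⟨ sym (*-distribˡ-+ 2 (rowSum m j) c) ⟩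
    2 * (rowSum m j + c)                      ∎
    where
    c = choose m (suc j)
    regroup : ∀ r a c → r + (a + c) + c ≡ (r + a) + 2 * c
    regroup = solve-∀ ℕ-ring

  central-double : ∀ n → choose (2 + 2 * n) (suc n) ≡ 2 * choose (1 + 2 * n) n
  central-double n = *-cancelˡ-≡ _ _ (suc n) (begin
    suc n * choose (2 + 2 * n) (suc n)  ≡⟨ absorption (1 + 2 * n) n ⟩
    (2 + 2 * n) * c                     ≡⟨ reorder n c ⟩
    suc n * (2 * c)                     ∎)
    where
    c = choose (1 + 2 * n) n
    reorder : ∀ n c → (2 + 2 * n) * c ≡ suc n * (2 * c)
    reorder = solve-∀ ℕ-ring

  central-step : ∀ n → rowSum (3 + 2 * n) (suc n) ≡ 2 * (rowSum (2 + 2 * n) n + choose (1 + 2 * n) n)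
  central-step n = +-cancelʳ-≡ (choose M (suc n)) _ _ (begin
    rowSum (suc M) (suc n) + choose M (suc n)  ≡⟨ rowSum-double M (suc n) ⟩
    2 * (rowSum M n + choose M (suc n))        ≡⟨ cong (λ t → 2 * (rowSum M n + t)) (central-double n) ⟩
    2 * (rowSum M n + 2 * c)                   ≡⟨ split (rowSum M n) c ⟩
    2 * (rowSum M n + c) + 2 * c               ≡⟨ cong (2 * (rowSum M n + c) +_) (sym (central-double n)) ⟩
    2 * (rowSum M n + c) + choose M (suc n)    ∎)
    where
    M = 2 + 2 * n
    c = choose (1 + 2 * n) n
    split : ∀ r c → 2 * (r + 2 * c) ≡ 2 * (r + c) + 2 * c
    split = solve-∀ ℕ-ring

  central-rowSum : ∀ n → rowSum (suc (2 * n)) n ≡ 2 ^ (2 * n)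
  central-rowSum zero    = refl
  central-rowSum (suc n) = begin
    rowSum (suc (2 * suc n)) (suc n)                 ≡⟨ cong (λ m → rowSum (suc m) (suc n)) (*-suc 2 n) ⟩
    rowSum (3 + 2 * n) (suc n)                       ≡⟨ central-step n ⟩
    2 * (rowSum (2 + 2 * n) n + choose (1 + 2 * n) n) ≡⟨ cong (2 *_) (rowSum-double (1 + 2 * n) n) ⟩
    2 * (2 * rowSum (1 + 2 * n) n)                   ≡⟨ cong (λ t → 2 * (2 * t)) (central-rowSum n) ⟩
    2 * (2 * 2 ^ (2 * n))                            ≡⟨ cong (2 ^_) (sym (*-suc 2 n)) ⟩
    2 ^ (2 * suc n)                                  ∎

open Binomial

import Data.Integer as ℤ
import Data.Integer.Properties as ℤ
open import Data.Rational using (ℚ; _+_; _*_; _-_; 0ℚ; 1ℚ; ½; _≟_; toℚᵘ)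
import Data.Rational.Properties as ℚ
import Data.Rational.Unnormalised as ℚᵘ
import Data.Rational.Unnormalised.Properties as ℚᵘ
import Tactic.RingSolver.Core.AlmostCommutativeRing as ACR

ℚ-ring : ACR.AlmostCommutativeRing _ _
ℚ-ring = ACR.fromCommutativeRing ℚ.+-*-commutativeRing (λ q → dec⇒maybe (0ℚ ≟ q))

-- A linear-combination principle: L = R follows from X = Y whenever L - R
-- and X - Y agree as polynomials (the latter checked by the ring solver).
by-difference : ∀ {L R X Y : ℚ} → X ≡ Y → L - R ≡ X - Y → L ≡ R
by-difference {L} {R} {X} refl d = begin
  L            ≡⟨ solve (L ∷ R ∷ []) ℚ-ring ⟩
  (L - R) + R  ≡⟨ cong (_+ R) d ⟩
  (X - X) + R  ≡⟨ solve (X ∷ R ∷ []) ℚ-ring ⟩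
  R            ∎
  where open ≡-Reasoning

ι : ℕ → ℚ
ι a = a ÷ℕ 1

÷ℕ-toℚᵘ : ∀ a d → toℚᵘ (a ÷ℕ suc d) ℚᵘ.≃ ℚᵘ.mkℚᵘ (ℤ.+ a) d
÷ℕ-toℚᵘ a d = ℚ.toℚᵘ-fromℚᵘ (ℚᵘ.mkℚᵘ (ℤ.+ a) d)

÷ℕ-+ : ∀ a b d → a ÷ℕ d + b ÷ℕ d ≡ (a ℕ.+ b) ÷ℕ d
÷ℕ-+ a b zero    = refl
÷ℕ-+ a b (suc d) = ℚ.toℚᵘ-injective (begin
  toℚᵘ (a ÷ℕ suc d + b ÷ℕ suc d)  ≈⟨ ℚ.toℚᵘ-homo-+ (a ÷ℕ suc d) (b ÷ℕ suc d) ⟩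
  toℚᵘ (a ÷ℕ suc d) ℚᵘ.+ toℚᵘ (b ÷ℕ suc d) ≈⟨ ℚᵘ.+-cong (÷ℕ-toℚᵘ a d) (÷ℕ-toℚᵘ b d) ⟩
  ℚᵘ.mkℚᵘ (ℤ.+ a) d ℚᵘ.+ ℚᵘ.mkℚᵘ (ℤ.+ b) d  ≈⟨ ℚᵘ.*≡* cross ⟩
  ℚᵘ.mkℚᵘ (ℤ.+ (a ℕ.+ b)) d           ≈⟨ ℚᵘ.≃-sym (÷ℕ-toℚᵘ (a ℕ.+ b) d) ⟩
  toℚᵘ ((a ℕ.+ b) ÷ℕ suc d)          ∎)
  where
  open ℚᵘ.≃-Reasoning
  cross : (ℤ.+ a ℤ.* ℤ.+ suc d ℤ.+ ℤ.+ b ℤ.* ℤ.+ suc d) ℤ.* ℤ.+ suc d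
          ≡ ℤ.+ (a ℕ.+ b) ℤ.* ℤ.+ (suc d ℕ.* suc d)
  cross rewrite ℤ.pos-+ a b | ℤ.pos-* (suc d) (suc d) = identity (ℤ.+ a) (ℤ.+ b) (ℤ.+ suc d)
    where
    identity : ∀ x y s → (x ℤ.* s ℤ.+ y ℤ.* s) ℤ.* s ≡ (x ℤ.+ y) ℤ.* (s ℤ.* s)
    identity = solve-∀ ℤ-ring

÷ℕ-* : ∀ a b d e → (a ÷ℕ d) * (b ÷ℕ e) ≡ (a ℕ.* b) ÷ℕ (d ℕ.* e)
÷ℕ-* a b zero    e       = ℚ.*-zeroˡ (b ÷ℕ e)
÷ℕ-* a b (suc d) zero    rewrite ℕ.*-zeroʳ d = ℚ.*-zeroʳ (a ÷ℕ suc d)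
÷ℕ-* a b (suc d) (suc e) = ℚ.toℚᵘ-injective (begin
  toℚᵘ ((a ÷ℕ suc d) * (b ÷ℕ suc e))         ≈⟨ ℚ.toℚᵘ-homo-* (a ÷ℕ suc d) (b ÷ℕ suc e) ⟩
  toℚᵘ (a ÷ℕ suc d) ℚᵘ.* toℚᵘ (b ÷ℕ suc e)   ≈⟨ ℚᵘ.*-cong (÷ℕ-toℚᵘ a d) (÷ℕ-toℚᵘ b e) ⟩
  ℚᵘ.mkℚᵘ (ℤ.+ a) d ℚᵘ.* ℚᵘ.mkℚᵘ (ℤ.+ b) e       ≈⟨ ℚᵘ.*≡* cross ⟩
  ℚᵘ.mkℚᵘ (ℤ.+ (a ℕ.* b)) (e ℕ.+ d ℕ.* suc e)  ≈⟨ ℚᵘ.≃-sym (÷ℕ-toℚᵘ (a ℕ.* b) _) ⟩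
  toℚᵘ ((a ℕ.* b) ÷ℕ (suc d ℕ.* suc e))      ∎)
  where
  open ℚᵘ.≃-Reasoning
  cross : (ℤ.+ a ℤ.* ℤ.+ b) ℤ.* ℤ.+ (suc d ℕ.* suc e) ≡ ℤ.+ (a ℕ.* b) ℤ.* (ℤ.+ suc d ℤ.* ℤ.+ suc e)
  cross = trans (cong (ℤ._* ℤ.+ (suc d ℕ.* suc e)) (sym (ℤ.pos-* a b)))
                (cong (ℤ.+ (a ℕ.* b) ℤ.*_) (ℤ.pos-* (suc d) (suc e)))

÷ℕ-cross : ∀ {a b d e} → d ≢ 0 → e ≢ 0 → a ℕ.* e ≡ b ℕ.* d → a ÷ℕ d ≡ b ÷ℕ e
÷ℕ-cross {d = zero}           d≢0 _   _  = ⊥-elim (d≢0 refl)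
÷ℕ-cross {d = suc d} {zero}   _   e≢0 _  = ⊥-elim (e≢0 refl)
÷ℕ-cross {a} {b} {suc d} {suc e} _ _ ae≡bd = ℚ.toℚᵘ-injective (begin
  toℚᵘ (a ÷ℕ suc d)  ≈⟨ ÷ℕ-toℚᵘ a d ⟩
  ℚᵘ.mkℚᵘ (ℤ.+ a) d    ≈⟨ ℚᵘ.*≡* cross ⟩
  ℚᵘ.mkℚᵘ (ℤ.+ b) e    ≈⟨ ℚᵘ.≃-sym (÷ℕ-toℚᵘ b e) ⟩
  toℚᵘ (b ÷ℕ suc e)  ∎)
  where
  open ℚᵘ.≃-Reasoning
  cross : ℤ.+ a ℤ.* ℤ.+ suc e ≡ ℤ.+ b ℤ.* ℤ.+ suc d
  cross = trans (sym (ℤ.pos-* a (suc e))) (trans (cong ℤ.+_ ae≡bd) (ℤ.pos-* b (suc d)))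

*-≢0 : ∀ {d e} → d ≢ 0 → e ≢ 0 → d ℕ.* e ≢ 0
*-≢0 {d} d≢0 e≢0 de≡0 with ℕ.m*n≡0⇒m≡0∨n≡0 d de≡0
... | inj₁ d≡0 = d≢0 d≡0
... | inj₂ e≡0 = e≢0 e≡0

÷ℕ-+-÷ℕ : ∀ {a b d e} → d ≢ 0 → e ≢ 0 → a ÷ℕ d + b ÷ℕ e ≡ (a ℕ.* e ℕ.+ b ℕ.* d) ÷ℕ (d ℕ.* e)
÷ℕ-+-÷ℕ {a} {b} {d} {e} d≢0 e≢0 = begin
  a ÷ℕ d + b ÷ℕ e
    ≡⟨ cong₂ _+_ (÷ℕ-cross d≢0 de≢0 (left a d e)) (÷ℕ-cross e≢0 de≢0 (right b d e)) ⟩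
  (a ℕ.* e) ÷ℕ (d ℕ.* e) + (b ℕ.* d) ÷ℕ (d ℕ.* e)  ≡⟨ ÷ℕ-+ (a ℕ.* e) (b ℕ.* d) (d ℕ.* e) ⟩
  (a ℕ.* e ℕ.+ b ℕ.* d) ÷ℕ (d ℕ.* e)         ∎
  where
  open ≡-Reasoning
  de≢0 = *-≢0 d≢0 e≢0
  left : ∀ a d e → a ℕ.* (d ℕ.* e) ≡ a ℕ.* e ℕ.* d
  left = solve-∀ ℕ-ring
  right : ∀ b d e → b ℕ.* (d ℕ.* e) ≡ b ℕ.* d ℕ.* e
  right = solve-∀ ℕ-ring

ι-+ : ∀ a b → ι (a ℕ.+ b) ≡ ι a + ι b
ι-+ a b = sym (÷ℕ-+ a b 1)

ι-* : ∀ a b → ι (a ℕ.* b) ≡ ι a * ι b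
ι-* a b = sym (÷ℕ-* a b 1 1)

ι-*-÷ℕ : ∀ c a d → ι c * (a ÷ℕ d) ≡ (c ℕ.* a) ÷ℕ d
ι-*-÷ℕ c a d = trans (÷ℕ-* c a 1 d) (cong ((c ℕ.* a) ÷ℕ_) (ℕ.+-identityʳ d))

÷ℕ-cancel : ∀ a {d} → d ≢ 0 → (a ℕ.* d) ÷ℕ d ≡ ι a
÷ℕ-cancel a {d} d≢0 = ÷ℕ-cross {a ℕ.* d} {a} {d} {1} d≢0 (λ ()) (ℕ.*-identityʳ _)

÷ℕ-self : ∀ {d} → d ≢ 0 → d ÷ℕ d ≡ 1ℚ
÷ℕ-self {d} d≢0 = ÷ℕ-cross {d} {1} {d} {1} d≢0 (λ ()) (trans (ℕ.*-identityʳ d) (sym (ℕ.*-identityˡ d)))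

ι-inverse : ∀ {d} → d ≢ 0 → ι d * (1 ÷ℕ d) ≡ 1ℚ
ι-inverse {d} d≢0 = trans (ι-*-÷ℕ d 1 d) (trans (cong (_÷ℕ d) (ℕ.*-identityʳ d)) (÷ℕ-self d≢0))

cancel-invertible : ∀ {δ w x y : ℚ} → δ * w ≡ 1ℚ → δ * x ≡ δ * y → x ≡ y
cancel-invertible {δ} {w} {x} {y} δw≡1 δx≡δy = by-difference
  (cong₂ _+_ (cong (w *_) δx≡δy) (cong ((x - y) *_) (sym δw≡1)))
  (solve (δ ∷ w ∷ x ∷ y ∷ []) ℚ-ring)

ι-cancel : ∀ {d x y} → d ≢ 0 → ι d * x ≡ ι d * y → x ≡ y
ι-cancel {d} d≢0 = cancel-invertible {ι d} {1 ÷ℕ d} (ι-inverse d≢0)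

-- Trading denominators: if p/d = q/d + r/e as numbers (i.e. p·e = q·e + r·d),
-- the same holds after multiplying every fraction's numerator by a.
÷ℕ-weights : ∀ a p q r {d e} → d ≢ 0 → e ≢ 0 → p ℕ.* e ≡ q ℕ.* e ℕ.+ r ℕ.* d →
             ι p * (a ÷ℕ d) ≡ ι q * (a ÷ℕ d) + ι r * (a ÷ℕ e)
÷ℕ-weights a p q r {d} {e} d≢0 e≢0 pe≡qe+rd = begin
  ι p * (a ÷ℕ d)                              ≡⟨ ι-*-÷ℕ p a d ⟩
  (p ℕ.* a) ÷ℕ d                              ≡⟨ ÷ℕ-cross d≢0 (*-≢0 d≢0 e≢0) cross ⟩
  (q ℕ.* a ℕ.* e ℕ.+ r ℕ.* a ℕ.* d) ÷ℕ (d ℕ.* e) ≡⟨ ÷ℕ-+-÷ℕ d≢0 e≢0 ⟨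
  (q ℕ.* a) ÷ℕ d + (r ℕ.* a) ÷ℕ e             ≡⟨ cong₂ _+_ (ι-*-÷ℕ q a d) (ι-*-÷ℕ r a e) ⟨
  ι q * (a ÷ℕ d) + ι r * (a ÷ℕ e)             ∎
  where
  open ≡-Reasoning
  factor : ∀ p a d e → p ℕ.* a ℕ.* (d ℕ.* e) ≡ a ℕ.* d ℕ.* (p ℕ.* e)
  factor = solve-∀ ℕ-ring
  expand : ∀ q r a d e → a ℕ.* d ℕ.* (q ℕ.* e ℕ.+ r ℕ.* d) ≡ (q ℕ.* a ℕ.* e ℕ.+ r ℕ.* a ℕ.* d) ℕ.* d
  expand = solve-∀ ℕ-ring
  cross : p ℕ.* a ℕ.* (d ℕ.* e) ≡ (q ℕ.* a ℕ.* e ℕ.+ r ℕ.* a ℕ.* d) ℕ.* d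
  cross = trans (factor p a d e) (trans (cong (a ℕ.* d ℕ.*_) pe≡qe+rd) (expand q r a d e))

Σ-cong : ∀ k {f g : ℕ → ℚ} → (∀ j → j ≤ k → f j ≡ g j) → Σ≤ k f ≡ Σ≤ k g
Σ-cong zero    f≗g = f≗g 0 z≤n
Σ-cong (suc k) f≗g = cong₂ _+_ (Σ-cong k (λ j j≤k → f≗g j (ℕ.m≤n⇒m≤1+n j≤k))) (f≗g (suc k) ℕ.≤-refl)

Σ-+ : ∀ k (f g : ℕ → ℚ) → Σ≤ k (λ j → f j + g j) ≡ Σ≤ k f + Σ≤ k g
Σ-+ zero    f g = refl
Σ-+ (suc k) f g = trans (cong (_+ (f (suc k) + g (suc k))) (Σ-+ k f g))
                        (interchange (Σ≤ k f) (Σ≤ k g) (f (suc k)) (g (suc k)))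
  where
  interchange : ∀ a b c d → (a + b) + (c + d) ≡ (a + c) + (b + d)
  interchange = solve-∀ ℚ-ring

Σ-* : ∀ k c (f : ℕ → ℚ) → Σ≤ k (λ j → c * f j) ≡ c * Σ≤ k f
Σ-* zero    c f = refl
Σ-* (suc k) c f = trans (cong (_+ c * f (suc k)) (Σ-* k c f)) (sym (ℚ.*-distribˡ-+ c (Σ≤ k f) (f (suc k))))

ratio : ℕ → ℕ → ℚ
ratio N j = rowSum (suc N) j ÷ℕ choose N j

ratioSum : ℕ → ℕ → ℚ
ratioSum N k = Σ≤ k (ratio N)

ratio-succ : ∀ {N j} → suc j ≤ N →
             ι (suc N) * ratio N (suc j) ≡ ι (suc j) * (ratio N j + ratio N (suc j)) + ι (suc N)
ratio-succ {N} {j} j<N = begin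
  ι (suc N) * (A′ ÷ℕ D′)                     ≡⟨ ÷ℕ-weights A′ (suc N) (suc j) (suc j) D′≢0 D≢0 weights ⟩
  ι (suc j) * x′ + ι (suc j) * (A′ ÷ℕ D)
    ≡⟨ cong (λ t → ι (suc j) * x′ + ι (suc j) * t) (÷ℕ-+ (rowSum (suc N) j) c D) ⟨
  ι (suc j) * x′ + ι (suc j) * (x + c ÷ℕ D)  ≡⟨ regroup (ι (suc j)) x x′ (c ÷ℕ D) ⟩
  ι (suc j) * (x + x′) + ι (suc j) * (c ÷ℕ D) ≡⟨ cong (ι (suc j) * (x + x′) +_) absorbed ⟩
  ι (suc j) * (x + x′) + ι (suc N)           ∎
  where
  open ≡-Reasoning
  D  = choose N j
  D′ = choose N (suc j)
  c  = choose (suc N) (suc j)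
  A′ = rowSum (suc N) (suc j)
  x  = ratio N j
  x′ = ratio N (suc j)
  D≢0  = choose-nonzero (ℕ.<⇒≤ j<N)
  D′≢0 = choose-nonzero j<N
  -- (N+1)·C(N,j) = (j+1)·C(N,j) + (j+1)·C(N,j+1), by absorption and Pascal
  weights : suc N ℕ.* D ≡ suc j ℕ.* D ℕ.+ suc j ℕ.* D′
  weights = trans (sym (absorption N j)) (ℕ.*-distribˡ-+ (suc j) D D′)
  absorbed : ι (suc j) * (c ÷ℕ D) ≡ ι (suc N)
  absorbed = trans (ι-*-÷ℕ (suc j) c D) (trans (cong (_÷ℕ D) (absorption N j)) (÷ℕ-cancel (suc N) D≢0))
  regroup : ∀ s x x′ t → s * x′ + s * (x + t) ≡ s * (x + x′) + s * t
  regroup = solve-∀ ℚ-ring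

ratio-raise : ∀ {N j} → j ≤ N →
              ι (suc N) * (ratio (suc N) j + 1ℚ) + ι j * (ι 2 * ratio N j) ≡ ι (suc N) * (ι 2 * ratio N j)
ratio-raise {N} {j} j≤N = begin
  ι (suc N) * (ratio (suc N) j + 1ℚ) + ι j * (ι 2 * ratio N j)
    ≡⟨ cong₂ (λ u v → ι (suc N) * u + ι j * v) doubled (ι-*-÷ℕ 2 a D) ⟩
  ι (suc N) * (2a ÷ℕ E) + ι j * (2a ÷ℕ D)   ≡⟨ ℚ.+-comm (ι (suc N) * (2a ÷ℕ E)) _ ⟩
  ι j * (2a ÷ℕ D) + ι (suc N) * (2a ÷ℕ E)   ≡⟨ ÷ℕ-weights 2a (suc N) j (suc N) D≢0 E≢0 (choose-shift N j) ⟨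
  ι (suc N) * (2a ÷ℕ D)                     ≡⟨ cong (ι (suc N) *_) (ι-*-÷ℕ 2 a D) ⟨
  ι (suc N) * (ι 2 * ratio N j)             ∎
  where
  open ≡-Reasoning
  a  = rowSum (suc N) j
  2a = 2 ℕ.* a
  D  = choose N j
  E  = choose (suc N) j
  D≢0 = choose-nonzero j≤N
  E≢0 = choose-nonzero (ℕ.m≤n⇒m≤1+n j≤N)
  doubled : ratio (suc N) j + 1ℚ ≡ 2a ÷ℕ E
  doubled = begin
    rowSum (suc (suc N)) j ÷ℕ E + 1ℚ       ≡⟨ cong (rowSum (suc (suc N)) j ÷ℕ E +_) (÷ℕ-self E≢0) ⟨
    rowSum (suc (suc N)) j ÷ℕ E + E ÷ℕ E   ≡⟨ ÷ℕ-+ (rowSum (suc (suc N)) j) E E ⟩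
    (rowSum (suc (suc N)) j ℕ.+ E) ÷ℕ E    ≡⟨ cong (_÷ℕ E) (rowSum-double (suc N) j) ⟩
    2a ÷ℕ E                                 ∎

-- The linear algebra of one step of `partial-raise`
-- (a = N+1, b = k+1; a₊ and b₊ stand for a+1 and b+1).
partial-raise-algebra : ∀ {a a₊ b b₊ P′ y P x₀ x₁ : ℚ} → a₊ ≡ ι 1 + a → b₊ ≡ ι 1 + b →
  a * P′ + b * x₀ ≡ a₊ * P →
  a * (y + 1ℚ) + b * (ι 2 * x₁) ≡ a * (ι 2 * x₁) →
  a * x₁ ≡ b * (x₀ + x₁) + a →
  a * (P′ + y) + b₊ * x₁ ≡ a₊ * (P + x₁)
partial-raise-algebra {a} {_} {b} {_} {P′} {y} {P} {x₀} {x₁} refl refl ih raise succ =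
  by-difference (cong₂ _+_ (cong₂ _+_ ih raise) succ) (solve (a ∷ b ∷ P′ ∷ y ∷ P ∷ x₀ ∷ x₁ ∷ []) ℚ-ring)

-- Summing the two recurrences:  (N+1)·P_{N+1}(k) + (k+1)·x_N(k) = (N+2)·P_N(k)  for k ≤ N.
partial-raise : ∀ {N k} → k ≤ N →
                ι (suc N) * ratioSum (suc N) k + ι (suc k) * ratio N k ≡ ι (suc (suc N)) * ratioSum N k
partial-raise {N} {zero}  _   = base {ι (suc N)} (ι-+ 1 (suc N))
  where
  base : ∀ {a a₊} → a₊ ≡ ι 1 + a → a * 1ℚ + ι 1 * 1ℚ ≡ a₊ * 1ℚ
  base {a} refl = solve (a ∷ []) ℚ-ring
partial-raise {N} {suc k} k<N =
  partial-raise-algebra {ι (suc N)} {_} {ι (suc k)} (ι-+ 1 (suc N)) (ι-+ 1 (suc k))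
    (partial-raise (ℕ.<⇒≤ k<N)) (ratio-raise k<N) (ratio-succ k<N)

shiftedRatio : ℕ → ℕ → ℚ
shiftedRatio N j = rowSum (suc (suc N)) j ÷ℕ choose N j

shiftedRatio-ratio : ∀ {N j} → j ≤ N →
                     shiftedRatio N j + ι (suc N) * (1 ÷ℕ (suc N ∸ j)) ≡ ι 2 * ratio N j
shiftedRatio-ratio {N} {j} j≤N = begin
  shiftedRatio N j + ι (suc N) * (1 ÷ℕ m)  ≡⟨ cong (shiftedRatio N j +_) complement ⟩
  shiftedRatio N j + E ÷ℕ D                ≡⟨ ÷ℕ-+ (rowSum (suc (suc N)) j) E D ⟩
  (rowSum (suc (suc N)) j ℕ.+ E) ÷ℕ D       ≡⟨ cong (_÷ℕ D) (rowSum-double (suc N) j) ⟩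
  (2 ℕ.* rowSum (suc N) j) ÷ℕ D             ≡⟨ ι-*-÷ℕ 2 (rowSum (suc N) j) D ⟨
  ι 2 * ratio N j                          ∎
  where
  open ≡-Reasoning
  m = suc N ∸ j
  D = choose N j
  E = choose (suc N) j
  complement : ι (suc N) * (1 ÷ℕ m) ≡ E ÷ℕ D
  complement = trans (ι-*-÷ℕ (suc N) 1 m)
    (÷ℕ-cross (ℕ.m>n⇒m∸n≢0 (s≤s j≤N)) (choose-nonzero j≤N) (begin
      suc N ℕ.* 1 ℕ.* D  ≡⟨ cong (ℕ._* D) (ℕ.*-identityʳ (suc N)) ⟩
      suc N ℕ.* D        ≡⟨ choose-complement j≤N ⟨
      m ℕ.* E            ≡⟨ ℕ.*-comm m E ⟩
      E ℕ.* m            ∎))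

shiftedSum : ∀ {N n} → n ≤ N →
             Σ≤ n (shiftedRatio N) + ι (suc N) * Σ≤ n (λ j → 1 ÷ℕ (suc N ∸ j)) ≡ ι 2 * ratioSum N n
shiftedSum {N} {n} n≤N = begin
  Σ≤ n (shiftedRatio N) + ι (suc N) * Σ≤ n h        ≡⟨ cong (Σ≤ n (shiftedRatio N) +_) (Σ-* n (ι (suc N)) h) ⟨
  Σ≤ n (shiftedRatio N) + Σ≤ n (λ j → ι (suc N) * h j) ≡⟨ Σ-+ n (shiftedRatio N) (λ j → ι (suc N) * h j) ⟨
  Σ≤ n (λ j → shiftedRatio N j + ι (suc N) * h j)    ≡⟨ Σ-cong n (λ j j≤n → shiftedRatio-ratio (ℕ.≤-trans j≤n n≤N)) ⟩
  Σ≤ n (λ j → ι 2 * ratio N j)                      ≡⟨ Σ-* n (ι 2) (ratio N) ⟩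
  ι 2 * ratioSum N n                                ∎
  where
  open ≡-Reasoning
  h : ℕ → ℚ
  h j = 1 ÷ℕ (suc N ∸ j)

harmonic-tail : ∀ {m k} → k ≤ m → Σ≤ k (λ j → 1 ÷ℕ (suc m ∸ j)) ≡ H (suc m) - H (m ∸ k)
harmonic-tail {m}     {zero}  _ = last (H m) (1 ÷ℕ suc m)
  where
  last : ∀ h w → w ≡ (h + w) - h
  last = solve-∀ ℚ-ring
harmonic-tail {suc m} {suc k} (s≤s k≤m) = begin
  Σ≤ k f + 1 ÷ℕ (suc m ∸ k)                    ≡⟨ cong (_+ 1 ÷ℕ (suc m ∸ k)) (harmonic-tail (ℕ.m≤n⇒m≤1+n k≤m)) ⟩
  (X - H (suc m ∸ k)) + 1 ÷ℕ (suc m ∸ k)       ≡⟨ cong (λ s → (X - H s) + 1 ÷ℕ s) (ℕ.+-∸-assoc 1 k≤m) ⟩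
  (X - (H (m ∸ k) + w)) + w                    ≡⟨ peel X (H (m ∸ k)) w ⟩
  X - H (m ∸ k)                                ∎
  where
  open ≡-Reasoning
  f : ℕ → ℚ
  f j = 1 ÷ℕ (suc (suc m) ∸ j)
  X = H (suc (suc m))
  w = 1 ÷ℕ suc (m ∸ k)
  peel : ∀ X h w → (X - (h + w)) + w ≡ X - h
  peel = solve-∀ ℚ-ring

oddHarmonic : ℕ → ℚ
oddHarmonic n = Σ≤ n (λ k → 1 ÷ℕ (2 ℕ.* k ℕ.+ 1))

oddHarmonic≡ : ∀ n → oddHarmonic n ≡ H (2 ℕ.* n ℕ.+ 1) - H n * ½
oddHarmonic≡ zero    = refl
oddHarmonic≡ (suc n) = begin
  oddHarmonic n + 1 ÷ℕ (2 ℕ.* suc n ℕ.+ 1)    ≡⟨ cong₂ _+_ (oddHarmonic≡ n) (cong (1 ÷ℕ_) next-odd) ⟩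
  (H m - H n * ½) + 1 ÷ℕ suc (suc m)          ≡⟨ add-terms (H m) (H n) (1 ÷ℕ suc n) _ even-term ⟩
  H (suc (suc m)) - H (suc n) * ½             ≡⟨ cong (λ t → H t - H (suc n) * ½) next-odd ⟨
  H (2 ℕ.* suc n ℕ.+ 1) - H (suc n) * ½       ∎
  where
  open ≡-Reasoning
  m = 2 ℕ.* n ℕ.+ 1
  next-odd : 2 ℕ.* suc n ℕ.+ 1 ≡ suc (suc m)
  next-odd = cong (ℕ._+ 1) (ℕ.*-suc 2 n)
  even-term : 1 ÷ℕ suc m ≡ (1 ÷ℕ suc n) * ½
  even-term = sym (trans (÷ℕ-* 1 1 (suc n) 2) (cong (1 ÷ℕ_) (double n)))
    where
    double : ∀ n → suc n ℕ.* 2 ≡ suc (2 ℕ.* n ℕ.+ 1)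
    double = solve-∀ ℕ-ring
  add-terms : ∀ h₁ h w₁ w₃ {w₂} → w₂ ≡ w₁ * ½ → (h₁ - h * ½) + w₃ ≡ ((h₁ + w₂) + w₃) - (h + w₁) * ½
  add-terms h₁ h w₁ w₃ refl = solve (h₁ ∷ h ∷ w₁ ∷ w₃ ∷ []) ℚ-ring

ι-affine : ∀ k n → ι (k ℕ.+ 2 ℕ.* n) ≡ ι k + ι 2 * ι n
ι-affine k n = trans (ι-+ k (2 ℕ.* n)) (cong (ι k +_) (ι-* 2 n))

n≤2n : ∀ n → n ≤ 2 ℕ.* n
n≤2n n = ℕ.m≤m+n n (n ℕ.+ 0)

central-ratio-succ : ∀ n → ratio (1 ℕ.+ 2 ℕ.* n) n + 1ℚ ≡ ratio (2 ℕ.+ 2 ℕ.* n) (suc n)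
central-ratio-succ n = begin
  r ÷ℕ c + 1ℚ                   ≡⟨ cong (r ÷ℕ c +_) (÷ℕ-self c≢0) ⟨
  r ÷ℕ c + c ÷ℕ c               ≡⟨ ÷ℕ-+ r c c ⟩
  (r ℕ.+ c) ÷ℕ c                ≡⟨ ÷ℕ-cross c≢0 (*-≢0 {2} (λ ()) c≢0) (double (r ℕ.+ c) c) ⟩
  (2 ℕ.* (r ℕ.+ c)) ÷ℕ (2 ℕ.* c) ≡⟨ cong₂ _÷ℕ_ (central-step n) (central-double n) ⟨
  ratio (2 ℕ.+ 2 ℕ.* n) (suc n) ∎
  where
  open ≡-Reasoning
  r = rowSum (2 ℕ.+ 2 ℕ.* n) n
  c = choose (1 ℕ.+ 2 ℕ.* n) n
  c≢0 = choose-nonzero (ℕ.m≤n⇒m≤1+n (n≤2n n))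
  double : ∀ a c → a ℕ.* (2 ℕ.* c) ≡ 2 ℕ.* a ℕ.* c
  double = solve-∀ ℕ-ring

-- The linear algebra of `odd-sum-from-even` (ν = n, s₁ = 2n+1, s₂ = 2n+2, t = n+1).
odd-from-even-algebra : ∀ {ν s₁ s₂ t F G c O : ℚ} →
  s₁ ≡ ι 1 + ι 2 * ν → s₂ ≡ ι 2 + ι 2 * ν → t ≡ ι 1 + ν →
  s₁ * F + t * c ≡ s₂ * G → G ≡ c * ½ + (ν + ½) * O → s₁ * F ≡ s₁ * (t * O)
odd-from-even-algebra {ν} {F = F} {G} {c} {O} refl refl refl raise even =
  by-difference (cong₂ _+_ raise (cong ((ι 2 + ι 2 * ν) *_) even))
    (solve (ν ∷ F ∷ G ∷ c ∷ O ∷ []) ℚ-ring)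

odd-sum-from-even : ∀ n →
  ratioSum (2 ℕ.* n) n ≡ ratio (2 ℕ.* n) n * ½ + (ι n + ½) * oddHarmonic n →
  ratioSum (1 ℕ.+ 2 ℕ.* n) n ≡ ι (suc n) * oddHarmonic n
odd-sum-from-even n even = ι-cancel {1 ℕ.+ 2 ℕ.* n} (λ ())
  (odd-from-even-algebra {ι n} (ι-affine 1 n) (ι-affine 2 n) (ι-+ 1 n) (partial-raise (n≤2n n)) even)

-- The linear algebra of the inductive step of `even-sum`
-- (ν = n, s₂ = 2n+2, s₃ = 2n+3, t = n+1).
even-step-algebra : ∀ {ν s₂ s₃ t P u c′ F O w : ℚ} →
  s₂ ≡ ι 2 + ι 2 * ν → s₃ ≡ ι 3 + ι 2 * ν → t ≡ ι 1 + ν →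
  s₂ * P + t * u ≡ s₃ * F → F ≡ t * O → u + 1ℚ ≡ c′ → s₃ * w ≡ 1ℚ →
  s₂ * (P + c′) ≡ s₂ * (c′ * ½ + (t + ½) * (O + w))
even-step-algebra {ν} {P = P} {u} {c′} {F} {O} {w} refl refl refl raise odd central inverse =
  by-difference
    (cong₂ _+_ (cong₂ _+_ raise (cong ((ι 3 + ι 2 * ν) *_) odd))
               (cong₂ _+_ (cong ((ι 1 + ν) *_) (sym central)) (cong ((ι 1 + ν) *_) (sym inverse))))
    (solve (ν ∷ P ∷ u ∷ c′ ∷ F ∷ O ∷ w ∷ []) ℚ-ring)

even-sum : ∀ n → ratioSum (2 ℕ.* n) n ≡ ratio (2 ℕ.* n) n * ½ + (ι n + ½) * oddHarmonic n
even-sum zero    = refl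
even-sum (suc n) = begin
  ratioSum (2 ℕ.* suc n) (suc n)                    ≡⟨ cong (λ N → ratioSum N (suc n)) (ℕ.*-suc 2 n) ⟩
  ratioSum M n + ratio M (suc n)                    ≡⟨ ι-cancel {M} (λ ()) step ⟩
  ratio M (suc n) * ½ + (ι (suc n) + ½) * oddHarmonic (suc n)
    ≡⟨ cong (λ N → ratio N (suc n) * ½ + (ι (suc n) + ½) * oddHarmonic (suc n)) (ℕ.*-suc 2 n) ⟨
  ratio (2 ℕ.* suc n) (suc n) * ½ + (ι (suc n) + ½) * oddHarmonic (suc n) ∎
  where
  open ≡-Reasoning
  M = 2 ℕ.+ 2 ℕ.* n
  next-odd : ∀ n → 2 ℕ.* suc n ℕ.+ 1 ≡ 3 ℕ.+ 2 ℕ.* n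
  next-odd = solve-∀ ℕ-ring
  inverse : ι (3 ℕ.+ 2 ℕ.* n) * (1 ÷ℕ (2 ℕ.* suc n ℕ.+ 1)) ≡ 1ℚ
  inverse = trans (cong (λ d → ι d * (1 ÷ℕ (2 ℕ.* suc n ℕ.+ 1))) (sym (next-odd n)))
                  (ι-inverse {2 ℕ.* suc n ℕ.+ 1} (λ ()))
  step = even-step-algebra {ι n} (ι-affine 2 n) (ι-affine 3 n) (ι-+ 1 n)
           (partial-raise (ℕ.m≤n⇒m≤1+n (n≤2n n)))
           (odd-sum-from-even n (even-sum n)) (central-ratio-succ n) inverse

odd-sum : ∀ n → ratioSum (1 ℕ.+ 2 ℕ.* n) n ≡ ι (suc n) * oddHarmonic n
odd-sum n = odd-sum-from-even n (even-sum n)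

central-ratio : ∀ n → ratio (2 ℕ.* n) n ≡ (2 ℕ.^ (2 ℕ.* n)) ÷ℕ ((2 ℕ.* n) C n)
central-ratio n = cong₂ _÷ℕ_ (central-rowSum n) (sym (C≡choose (2 ℕ.* n) n))

2n∸n≡n : ∀ n → 2 ℕ.* n ∸ n ≡ n
2n∸n≡n n = trans (ℕ.m+n∸m≡n n (n ℕ.+ 0)) (ℕ.+-identityʳ n)

-- The linear algebra of `shifted-odd-sum` (ν = n, s₂ = 2n+2, t = n+1).
shifted-odd-algebra : ∀ {ν s₂ t Sy Sh F O h₁ h w₁ w₂ : ℚ} → s₂ ≡ ι 2 + ι 2 * ν → t ≡ ι 1 + ν →
  Sy + s₂ * Sh ≡ ι 2 * F → F ≡ t * O → O ≡ h₁ - h * ½ → Sh ≡ (h₁ + w₂) - (h + w₁) →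
  s₂ * w₂ ≡ 1ℚ → t * w₁ ≡ 1ℚ → Sy ≡ t * (h + w₁)
shifted-odd-algebra {ν} {Sy = Sy} {Sh} {F} {O} {h₁} {h} {w₁} {w₂} refl refl shifted odd odd≡ tail inv₂ inv₁ =
  by-difference
    (cong₂ _+_ (cong₂ _+_ (cong₂ _+_ shifted (cong ((ι 2 + ι 2 * ν) *_) (sym tail)))
                          (cong₂ _+_ (cong (ι 2 *_) odd) (cong ((ι 2 * (ι 1 + ν)) *_) odd≡)))
               (cong₂ _+_ (sym inv₂) inv₁))
    (solve (ν ∷ Sy ∷ Sh ∷ F ∷ O ∷ h₁ ∷ h ∷ w₁ ∷ w₂ ∷ []) ℚ-ring)

shifted-odd-sum : ∀ n → Σ≤ n (shiftedRatio (1 ℕ.+ 2 ℕ.* n)) ≡ ι (suc n) * H (suc n)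
shifted-odd-sum n =
  shifted-odd-algebra {ι n} {h₁ = H (1 ℕ.+ 2 ℕ.* n)} {h = H n} (ι-affine 2 n) (ι-+ 1 n)
    (shiftedSum (ℕ.m≤n⇒m≤1+n (n≤2n n))) (odd-sum n)
    (trans (oddHarmonic≡ n) (cong (λ m → H m - H n * ½) (ℕ.+-comm (2 ℕ.* n) 1)))
    (trans (harmonic-tail (ℕ.m≤n⇒m≤1+n (n≤2n n)))
           (cong (λ m → H (2 ℕ.+ 2 ℕ.* n) - H m) (trans (ℕ.+-∸-assoc 1 (n≤2n n)) (cong suc (2n∸n≡n n)))))
    (ι-inverse {2 ℕ.+ 2 ℕ.* n} (λ ())) (ι-inverse {suc n} (λ ()))

-- The linear algebra of `shifted-even-sum` (ν = n, s₁ = 2n+1).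
shifted-even-algebra : ∀ {ν s₁ Sy Sh G c O h₁ h : ℚ} → s₁ ≡ ι 1 + ι 2 * ν →
  Sy + s₁ * Sh ≡ ι 2 * G → G ≡ c * ½ + (ν + ½) * O → O ≡ h₁ - h * ½ → Sh ≡ h₁ - h →
  Sy ≡ c + (ν + ½) * h
shifted-even-algebra {ν} {Sy = Sy} {Sh} {G} {c} {O} {h₁} {h} refl shifted even odd≡ tail =
  by-difference
    (cong₂ _+_ (cong₂ _+_ shifted (cong ((ι 1 + ι 2 * ν) *_) (sym tail)))
               (cong₂ _+_ (cong (ι 2 *_) even) (cong ((ι 1 + ι 2 * ν) *_) odd≡)))
    (solve (ν ∷ Sy ∷ Sh ∷ G ∷ c ∷ O ∷ h₁ ∷ h ∷ []) ℚ-ring)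

shifted-even-sum : ∀ n → Σ≤ n (shiftedRatio (2 ℕ.* n)) ≡ ratio (2 ℕ.* n) n + (ι n + ½) * H n
shifted-even-sum n =
  shifted-even-algebra {ι n} {c = ratio (2 ℕ.* n) n} {h₁ = H (1 ℕ.+ 2 ℕ.* n)} {h = H n}
    (ι-affine 1 n) (shiftedSum (n≤2n n)) (even-sum n)
    (trans (oddHarmonic≡ n) (cong (λ m → H m - H n * ½) (ℕ.+-comm (2 ℕ.* n) 1)))
    (trans (harmonic-tail (n≤2n n)) (cong (λ m → H (1 ℕ.+ 2 ℕ.* n) - H m) (2n∸n≡n n)))

doubleSum : ℕ → ℕ → ℕ → ℚ
doubleSum m N n = Σ≤ n (λ j → Σ≤ j (λ i → (m C i) ÷ℕ (N C j)))

doubleSum-rows : ∀ m N n → doubleSum m N n ≡ Σ≤ n (λ j → rowSum m j ÷ℕ choose N j)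
doubleSum-rows m N n = Σ-cong n (λ j _ → trans (inner (N C j) j) (cong (rowSum m j ÷ℕ_) (C≡choose N j)))
  where
  inner : ∀ d j → Σ≤ j (λ i → (m C i) ÷ℕ d) ≡ rowSum m j ÷ℕ d
  inner d zero    = cong (_÷ℕ d) (C≡choose m 0)
  inner d (suc j) = trans (cong₂ _+_ (inner d j) (cong (_÷ℕ d) (C≡choose m (suc j))))
                          (÷ℕ-+ (rowSum m j) (choose m (suc j)) d)

corollary6 : (n : ℕ) →
    ((Σ≤ n (λ j → Σ≤ j (λ i → ((2 ℕ.* n ℕ.+ 2) C i) ÷ℕ ((2 ℕ.* n ℕ.+ 1) C j)))
        ≡ (suc n ÷ℕ 1) * Σ≤ n (λ k → 1 ÷ℕ (2 ℕ.* k ℕ.+ 1)))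
      × ((suc n ÷ℕ 1) * Σ≤ n (λ k → 1 ÷ℕ (2 ℕ.* k ℕ.+ 1))
        ≡ (suc n ÷ℕ 1) * (H (2 ℕ.* n ℕ.+ 1) - H n * ½)))
    × (Σ≤ n (λ j → Σ≤ j (λ i → ((2 ℕ.* n ℕ.+ 3) C i) ÷ℕ ((2 ℕ.* n ℕ.+ 1) C j)))
        ≡ (suc n ÷ℕ 1) * H (suc n))
    × (Σ≤ n (λ j → Σ≤ j (λ i → ((2 ℕ.* n ℕ.+ 1) C i) ÷ℕ ((2 ℕ.* n) C j)))
        ≡ ((2 ℕ.^ (2 ℕ.* n)) ÷ℕ ((2 ℕ.* n) C n)) * ½
          + ((n ÷ℕ 1) + ½) * (H (2 ℕ.* n ℕ.+ 1) - H n * ½))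
    × (Σ≤ n (λ j → Σ≤ j (λ i → ((2 ℕ.* n ℕ.+ 2) C i) ÷ℕ ((2 ℕ.* n) C j)))
        ≡ (2 ℕ.^ (2 ℕ.* n)) ÷ℕ ((2 ℕ.* n) C n)
          + ((n ÷ℕ 1) + ½) * H n)
corollary6 n =
  ( (trans (rows (ℕ.+-comm _ 2) (ℕ.+-comm _ 1)) (odd-sum n) , cong (ι (suc n) *_) (oddHarmonic≡ n))
  , trans (rows (ℕ.+-comm _ 3) (ℕ.+-comm _ 1)) (shifted-odd-sum n)
  , trans (rows (ℕ.+-comm _ 1) refl) (trans (even-sum n)
      (cong₂ (λ c O → c * ½ + (ι n + ½) * O) (central-ratio n) (oddHarmonic≡ n)))
  , trans (rows (ℕ.+-comm _ 2) refl) (trans (shifted-even-sum n) (cong (_+ (ι n + ½) * H n) (central-ratio n))) )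
  where
  rows : ∀ {m m′ N N′} → m ≡ m′ → N ≡ N′ → doubleSum m N n ≡ Σ≤ n (λ j → rowSum m′ j ÷ℕ choose N′ j)
  rows refl refl = doubleSum-rows _ _ n
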